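{- Let $Q$ be a finite (left) quasifield with $q$ elements. If $P$ is a set of points and $L$ is a set of lines in $Q^2$, then \[ |\{(p,l)\in P\times L : p \in l\}| \leq \frac{|P||L|}{q} + q^{1/2}\sqrt{|P||L|}. \]
   Context: A (left) quasifield is a set $Q$ with two binary operations $+$ and $\cdot$ such that $(Q,+)$ is a group with identity $0$; $(Q\setminus\{0\},\cdot)$ is a loop (for all $a,b$ the equations $a\cdot x=b$ and $y\cdot a=b$ have unique solutions, and there is an identity $1$); $a\cdot(b+c)=a\cdot b+a\cdot c$ for all $a,b,c$; $0\cdot x=0$ for all $x$; and for $a\neq b$ the equation $a\cdot x=b\cdot x+c$ has exactly one solution $x$. A line in $Q^2$ is, for some $a,b\in Q$, a set of the form $\{(x,y)\in Q^2 : y = b\cdot x + a\}$ or $\{(a,y): y\in Q\}$. -}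

module Defs where

open import Level using (Level; suc; _⊔_)
open import Data.Nat using (ℕ)
open import Data.Fin using (Fin)
import Data.Fin.Properties as FinP
open import Data.Product using (Σ; _×_; _,_)
open import Data.Sum using (_⊎_)
open import Data.List using (List; []; _∷_)
open import Algebra.Core using (Op₁; Op₂)
open import Algebra.Structures using (IsGroup)
open import Function.Bundles using (_↔_; Inverse)
open import Relation.Nullary using (¬_; Dec; yes; no)
open import Relation.Nullary.Decidable using (map′; _⊎-dec_)
open import Relation.Binary.Definitions using (DecidableEquality)
open import Relation.Binary.PropositionalEquality
  using (_≡_; _≢_; refl; sym; trans; cong)

ExactlyOne : ∀ {a p} (A : Set a) → (A → Set p) → Set (a ⊔ p)
ExactlyOne A R = Σ A λ x → R x × (∀ y → R y → y ≡ x)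

record IsQuasifield {c} {Q : Set c} (_+_ _·_ : Op₂ Q) (-_ : Op₁ Q) (0# 1# : Q) : Set c where
  field
    -- (Q,+) is a group with identity 0 (not assumed abelian)
    +-isGroup : IsGroup _≡_ _+_ 0# -_
    -- (Q \ {0}, ·) is a loop with identity 1
    1≢0       : 1# ≢ 0#
    ·-closed  : ∀ a b → a ≢ 0# → b ≢ 0# → (a · b) ≢ 0#
    ·-identityˡ : ∀ x → x ≢ 0# → 1# · x ≡ x
    ·-identityʳ : ∀ x → x ≢ 0# → x · 1# ≡ x
    ·-leftDiv  : ∀ a b → a ≢ 0# → b ≢ 0# → ExactlyOne Q (λ x → x ≢ 0# × a · x ≡ b)
    ·-rightDiv : ∀ a b → a ≢ 0# → b ≢ 0# → ExactlyOne Q (λ y → y ≢ 0# × y · a ≡ b)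
    distribˡ  : ∀ a b c → a · (b + c) ≡ (a · b) + (a · c)
    zeroˡ     : ∀ x → 0# · x ≡ 0#
    uniqueSol : ∀ a b c → a ≢ b → ExactlyOne Q (λ x → a · x ≡ (b · x) + c)

record Quasifield (c : Level) : Set (suc c) where
  field
    Carrier : Set c
    _+_ _·_ : Op₂ Carrier
    -_      : Op₁ Carrier
    0# 1#   : Carrier
    isQuasifield : IsQuasifield _+_ _·_ -_ 0# 1#
  open IsQuasifield isQuasifield public

module _ {c} (Q : Quasifield c) where
  open Quasifield Q

  -- Lines of Q²: y = b·x + a  (nonvertical b a)  or  x = a  (vertical a).
  -- Distinct parameters give distinct point sets, so a set of lines is a
  -- duplicate-free list of parameters.
  data Line : Set c where
    nonvertical : (b a : Carrier) → Line
    vertical    : (a : Carrier) → Line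

  _∈ₗ_ : Carrier × Carrier → Line → Set c
  (x , y) ∈ₗ nonvertical b a = y ≡ (b · x) + a
  (x , y) ∈ₗ vertical a      = x ≡ a

  module _ (_≟_ : DecidableEquality Carrier) where
    _∈ₗ?_ : ∀ p l → Dec (p ∈ₗ l)
    (x , y) ∈ₗ? nonvertical b a = y ≟ ((b · x) + a)
    (x , y) ∈ₗ? vertical a      = x ≟ a

    incidences : List (Carrier × Carrier) → List Line → ℕ
    incidences [] L = 0
    incidences (p ∷ P) L = count L Data.Nat.+ incidences P L
      where
      count : List Line → ℕ
      count [] = 0
      count (l ∷ L) with p ∈ₗ? l
      ... | yes _ = Data.Nat.suc (count L)
      ... | no  _ = count L

finDecEq : ∀ {c} {A : Set c} {q : ℕ} → Fin q ↔ A → DecidableEquality A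
finDecEq e x y = map′ (λ p → trans (sym (strictlyInverseˡ x)) (trans (cong to p) (strictlyInverseˡ y)))
                      (cong from) (FinP._≟_ (from x) (from y))
  where open Inverse e

module Submission where

-- The plane over a quasifield with q elements is a finite linear space: every
-- point lies on q + 1 of its q² + q lines and two distinct points lie on exactly
-- one common line. For a set P of N points write n(l) for the number of points
-- of P on the line l. Double counting point–line and point-pair–line incidences
-- gives Σ n(l) = N(q + 1) and Σ n(l)² = N(N + q) over all lines, hence the
-- variance identity Σ (q n(l) − N)² = q³N − qN² ≤ q³N. For a set L of lines,
-- q·I(P, L) − |L|N = Σ_{l ∈ L} (q n(l) − N), and Cauchy–Schwarz over L together
-- with the variance bound give (q·I(P, L) − |L|N)² ≤ |L| q³ N.

module PlaneIncidences where

  open import Defs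
  open import Algebra.Bundles using (Group)
  open import Algebra.Structures using (IsGroup)
  import Algebra.Properties.Group as GroupProperties
  open import Data.Empty using (⊥-elim)
  open import Data.Fin using (Fin)
  open import Data.Integer as ℤ using (ℤ; +_; _+_; _*_; _-_; -_; _≤_; 0ℤ; 1ℤ)
  import Data.Integer.Properties as ℤ
  open import Data.Integer.Tactic.RingSolver using (solve-∀)
  open import Data.List
    using (List; []; _∷_; _++_; length; map; allFin; cartesianProduct)
  open import Data.List.Membership.Propositional using (_∈_)
  open import Data.List.Membership.Propositional.Properties
    using (∈-map⁺; ∈-map⁻; ∈-++⁺ˡ; ∈-++⁺ʳ; ∈-++⁻; ∈-∃++; ∈-cartesianProduct⁺; ∈-allFin)
  open import Data.List.Properties using (length-map; length-++; length-tabulate)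
  open import Data.List.Relation.Binary.Subset.Propositional using (_⊆_)
  open import Data.List.Relation.Unary.All as All using (All; _∷_)
  open import Data.List.Relation.Unary.AllPairs using (_∷_)
  open import Data.List.Relation.Unary.Any using (here; there)
  open import Data.List.Relation.Unary.Unique.Propositional using (Unique)
  import Data.List.Relation.Unary.Unique.Propositional.Properties as Unique
  open import Data.Nat as ℕ using (ℕ; suc; z≤n; _∸_; _^_)
  import Data.Nat.Properties as ℕ
  open import Data.Product using (_×_; _,_; proj₁; proj₂; uncurry)
  open import Data.Product.Properties using (≡-dec)
  open import Data.Sum using (inj₁; inj₂)
  open import Function.Bundles using (_↔_; Inverse; Injection)
  open import Function.Properties.Inverse using (↔⇒↣)
  open import Relation.Binary.Definitions using (DecidableEquality)
  open import Relation.Binary.PropositionalEquality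
  open import Relation.Nullary using (Dec; yes; no; ¬_)
  open import Relation.Nullary.Decidable using (_×-dec_)

  square-nonNeg : ∀ i → 0ℤ ≤ i * i
  square-nonNeg (+ m)      = subst (0ℤ ≤_) (ℤ.pos-* m m) (ℤ.+≤+ z≤n)
  square-nonNeg ℤ.-[1+ m ] = ℤ.+≤+ z≤n

  ∸-squared-≤ : ∀ m n k → (+ m - + n) * (+ m - + n) ≤ + k → (m ∸ n) ^ 2 ℕ.≤ k
  ∸-squared-≤ m n k bound with ℕ.≤-total m n
  ... | inj₁ m≤n rewrite ℕ.m≤n⇒m∸n≡0 m≤n = z≤n
  ... | inj₂ n≤m = ℤ.drop‿+≤+ (subst (_≤ + k) (sym cast) bound)
    where
    open ≡-Reasoning
    cast : + ((m ∸ n) ^ 2) ≡ (+ m - + n) * (+ m - + n)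
    cast = begin
      + ((m ∸ n) ℕ.* ((m ∸ n) ℕ.* 1)) ≡⟨ cong (λ k → + ((m ∸ n) ℕ.* k)) (ℕ.*-identityʳ (m ∸ n)) ⟩
      + ((m ∸ n) ℕ.* (m ∸ n))         ≡⟨ ℤ.pos-* (m ∸ n) (m ∸ n) ⟩
      + (m ∸ n) * + (m ∸ n)           ≡⟨ cong (λ i → i * i) (trans (ℤ.m-n≡m⊖n m n) (ℤ.⊖-≥ n≤m)) ⟨
      (+ m - + n) * (+ m - + n)       ∎

  pos-^3 : ∀ n → + (n ^ 3) ≡ + n * + n * + n
  pos-^3 n = begin
    + (n ℕ.* (n ℕ.* (n ℕ.* 1))) ≡⟨ ℤ.pos-* n _ ⟩
    + n * + (n ℕ.* (n ℕ.* 1))   ≡⟨ cong (+ n *_) (trans (ℤ.pos-* n _) (cong (+ n *_) (ℤ.pos-* n 1))) ⟩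
    + n * (+ n * (+ n * 1ℤ))    ≡⟨ reassociate (+ n) ⟩
    + n * + n * + n             ∎
    where
    open ≡-Reasoning
    reassociate : ∀ i → i * (i * (i * 1ℤ)) ≡ i * i * i
    reassociate = solve-∀

  module _ {a} {A : Set a} where

    ∑ : List A → (A → ℤ) → ℤ
    ∑ []       f = 0ℤ
    ∑ (x ∷ xs) f = f x + ∑ xs f

    syntax ∑ xs (λ x → e) = ∑[ x ∈ xs ] e

    ∑-cong-∈ : ∀ xs {f g : A → ℤ} → (∀ {x} → x ∈ xs → f x ≡ g x) → ∑ xs f ≡ ∑ xs g
    ∑-cong-∈ []       f≡g = refl
    ∑-cong-∈ (x ∷ xs) f≡g = cong₂ _+_ (f≡g (here refl)) (∑-cong-∈ xs (λ m → f≡g (there m)))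

    ∑-cong : ∀ xs {f g : A → ℤ} → (∀ x → f x ≡ g x) → ∑ xs f ≡ ∑ xs g
    ∑-cong xs f≡g = ∑-cong-∈ xs (λ {x} _ → f≡g x)

    ∑-+ : ∀ xs (f g : A → ℤ) → ∑[ x ∈ xs ] (f x + g x) ≡ ∑ xs f + ∑ xs g
    ∑-+ []       f g = refl
    ∑-+ (x ∷ xs) f g = trans (cong (_+_ (f x + g x)) (∑-+ xs f g)) (shuffle (f x) (g x) _ _)
      where
      shuffle : ∀ a b c d → (a + b) + (c + d) ≡ (a + c) + (b + d)
      shuffle = solve-∀

    ∑-*ˡ : ∀ xs c (f : A → ℤ) → ∑[ x ∈ xs ] (c * f x) ≡ c * ∑ xs f
    ∑-*ˡ []       c f = sym (ℤ.*-zeroʳ c)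
    ∑-*ˡ (x ∷ xs) c f =
      trans (cong (_+_ (c * f x)) (∑-*ˡ xs c f)) (sym (ℤ.*-distribˡ-+ c (f x) (∑ xs f)))

    ∑-*ʳ : ∀ xs c (f : A → ℤ) → ∑[ x ∈ xs ] (f x * c) ≡ ∑ xs f * c
    ∑-*ʳ []       c f = sym (ℤ.*-zeroˡ c)
    ∑-*ʳ (x ∷ xs) c f =
      trans (cong (_+_ (f x * c)) (∑-*ʳ xs c f)) (sym (ℤ.*-distribʳ-+ c (f x) (∑ xs f)))

    ∑-const : ∀ xs c → ∑[ _ ∈ xs ] c ≡ + length xs * c
    ∑-const []       c = sym (ℤ.*-zeroˡ c)
    ∑-const (x ∷ xs) c = trans (cong (_+_ c) (∑-const xs c)) (sym (ℤ.suc-* (+ length xs) c))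

    ∑-zero : ∀ xs → ∑[ _ ∈ xs ] 0ℤ ≡ 0ℤ
    ∑-zero xs = trans (∑-const xs 0ℤ) (ℤ.*-zeroʳ (+ length xs))

    ∑-++ : ∀ xs ys (f : A → ℤ) → ∑ (xs ++ ys) f ≡ ∑ xs f + ∑ ys f
    ∑-++ []       ys f = sym (ℤ.+-identityˡ (∑ ys f))
    ∑-++ (x ∷ xs) ys f = trans (cong (_+_ (f x)) (∑-++ xs ys f)) (sym (ℤ.+-assoc (f x) _ _))

    ∑-++-∷ : ∀ xs y ys (f : A → ℤ) → ∑ (xs ++ y ∷ ys) f ≡ f y + ∑ (xs ++ ys) f
    ∑-++-∷ []       y ys f = refl
    ∑-++-∷ (x ∷ xs) y ys f = trans (cong (_+_ (f x)) (∑-++-∷ xs y ys f)) (swap (f x) (f y) _)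
      where
      swap : ∀ a b c → a + (b + c) ≡ b + (a + c)
      swap = solve-∀

    ∑-nonNeg : ∀ xs {f : A → ℤ} → (∀ x → 0ℤ ≤ f x) → 0ℤ ≤ ∑ xs f
    ∑-nonNeg []       f≥0 = ℤ.≤-refl
    ∑-nonNeg (x ∷ xs) f≥0 = ℤ.+-mono-≤ (f≥0 x) (∑-nonNeg xs f≥0)

    ∑-mono-⊆ : ∀ {f : A → ℤ} → (∀ x → 0ℤ ≤ f x) →
               ∀ {xs ys} → Unique xs → xs ⊆ ys → ∑ xs f ≤ ∑ ys f
    ∑-mono-⊆ f≥0 {[]}     {ys} _                xs⊆ys = ∑-nonNeg ys f≥0
    ∑-mono-⊆ {f} f≥0 {x ∷ xs} (x∉xs ∷ xs-unique) xs⊆ys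
      with us , vs , refl ← ∈-∃++ (xs⊆ys (here refl)) = begin
        f x + ∑ xs f          ≤⟨ ℤ.+-monoʳ-≤ (f x) (∑-mono-⊆ f≥0 xs-unique xs⊆us++vs) ⟩
        f x + ∑ (us ++ vs) f  ≡⟨ ∑-++-∷ us x vs f ⟨
        ∑ (us ++ x ∷ vs) f    ∎
      where
      open ℤ.≤-Reasoning
      xs⊆us++vs : xs ⊆ us ++ vs
      xs⊆us++vs y∈xs with ∈-++⁻ us (xs⊆ys (there y∈xs))
      ... | inj₁ y∈us         = ∈-++⁺ˡ y∈us
      ... | inj₂ (here y≡x)   = ⊥-elim (All.lookup x∉xs y∈xs (sym y≡x))
      ... | inj₂ (there y∈vs) = ∈-++⁺ʳ us y∈vs

    -- Lagrange: ∑ᵢ ∑ⱼ (f i − f j)² = 2 (n T − s²).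
    cauchy-schwarz : ∀ xs (f : A → ℤ) →
                     ∑ xs f * ∑ xs f ≤ + length xs * ∑[ x ∈ xs ] (f x * f x)
    cauchy-schwarz xs f = ℤ.0≤i-j⇒j≤i (ℤ.*-cancelˡ-≤-pos 0ℤ _ (+ 2)
                            (subst (0ℤ ≤_) double-sum (∑-nonNeg xs λ i → ∑-nonNeg xs λ j → square-nonNeg (f i - f j))))
      where
      n s T : ℤ
      n = + length xs
      s = ∑ xs f
      T = ∑[ x ∈ xs ] (f x * f x)

      expand : ∀ a b → (a - b) * (a - b) ≡ a * a + (b * b + - + 2 * (a * b))
      expand = solve-∀

      collect : ∀ n T s → n * T + (n * T + - + 2 * (s * s)) ≡ + 2 * (n * T - s * s)
      collect = solve-∀

      inner : ∀ i → ∑[ j ∈ xs ] ((f i - f j) * (f i - f j)) ≡ f i * f i * n + (T + - + 2 * s * f i)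
      inner i = begin
        ∑[ j ∈ xs ] ((f i - f j) * (f i - f j))
          ≡⟨ ∑-cong xs (λ j → expand (f i) (f j)) ⟩
        ∑[ j ∈ xs ] (f i * f i + (f j * f j + - + 2 * (f i * f j)))
          ≡⟨ trans (∑-+ xs (λ _ → f i * f i) (λ j → f j * f j + - + 2 * (f i * f j)))
                   (cong (_+_ (∑[ j ∈ xs ] (f i * f i))) (∑-+ xs (λ j → f j * f j) (λ j → - + 2 * (f i * f j)))) ⟩
        ∑[ j ∈ xs ] (f i * f i) + (T + ∑[ j ∈ xs ] (- + 2 * (f i * f j)))
          ≡⟨ cong₂ (λ u v → u + (T + v)) (trans (∑-const xs (f i * f i)) (ℤ.*-comm n (f i * f i)))
                   (trans (∑-*ˡ xs (- + 2) (λ j → f i * f j)) (cong (- + 2 *_) (∑-*ˡ xs (f i) f))) ⟩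
        f i * f i * n + (T + - + 2 * (f i * s))
          ≡⟨ cong (λ u → f i * f i * n + (T + u)) (reorder (f i) s) ⟩
        f i * f i * n + (T + - + 2 * s * f i) ∎
        where
        open ≡-Reasoning
        reorder : ∀ a s → - + 2 * (a * s) ≡ - + 2 * s * a
        reorder = solve-∀

      double-sum : ∑[ i ∈ xs ] ∑[ j ∈ xs ] ((f i - f j) * (f i - f j)) ≡ + 2 * (n * T - s * s)
      double-sum = begin
        ∑[ i ∈ xs ] ∑[ j ∈ xs ] ((f i - f j) * (f i - f j))
          ≡⟨ ∑-cong xs inner ⟩
        ∑[ i ∈ xs ] (f i * f i * n + (T + - + 2 * s * f i))
          ≡⟨ trans (∑-+ xs (λ i → f i * f i * n) (λ i → T + - + 2 * s * f i))
                   (cong₂ _+_ (∑-*ʳ xs n (λ i → f i * f i))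
                     (trans (∑-+ xs (λ _ → T) (λ i → - + 2 * s * f i)) (cong₂ _+_ (∑-const xs T) (∑-*ˡ xs (- + 2 * s) f)))) ⟩
        T * n + (n * T + - + 2 * s * s)
          ≡⟨ cong (_+ (n * T + - + 2 * s * s)) (ℤ.*-comm T n) ⟩
        n * T + (n * T + - + 2 * s * s)
          ≡⟨ cong (λ u → n * T + (n * T + u)) (ℤ.*-assoc (- + 2) s s) ⟩
        n * T + (n * T + - + 2 * (s * s))
          ≡⟨ collect n T s ⟩
        + 2 * (n * T - s * s) ∎
        where open ≡-Reasoning

  module _ {a b} {A : Set a} {B : Set b} where

    ∑-map : ∀ (g : A → B) xs (f : B → ℤ) → ∑ (map g xs) f ≡ ∑[ x ∈ xs ] f (g x)
    ∑-map g []       f = refl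
    ∑-map g (x ∷ xs) f = cong (_+_ (f (g x))) (∑-map g xs f)

    ∑-swap : ∀ xs ys (f : A → B → ℤ) → ∑[ x ∈ xs ] ∑[ y ∈ ys ] f x y ≡ ∑[ y ∈ ys ] ∑[ x ∈ xs ] f x y
    ∑-swap []       ys f = sym (∑-zero ys)
    ∑-swap (x ∷ xs) ys f =
      trans (cong (_+_ (∑ ys (f x))) (∑-swap xs ys f)) (sym (∑-+ ys (f x) (λ y → ∑[ x ∈ xs ] f x y)))

    ∑-*-∑ : ∀ xs ys (f : A → ℤ) (g : B → ℤ) → ∑ xs f * ∑ ys g ≡ ∑[ x ∈ xs ] ∑[ y ∈ ys ] (f x * g y)
    ∑-*-∑ xs ys f g = trans (sym (∑-*ʳ xs (∑ ys g) f)) (∑-cong xs (λ x → sym (∑-*ˡ ys (f x) g)))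

  module _ {a b} {A : Set a} {B : Set b} where

    ∑-cartesianProduct : ∀ xs ys (f : A × B → ℤ) →
                         ∑ (cartesianProduct xs ys) f ≡ ∑[ x ∈ xs ] ∑[ y ∈ ys ] f (x , y)
    ∑-cartesianProduct []       ys f = refl
    ∑-cartesianProduct (x ∷ xs) ys f = begin
      ∑ (map (x ,_) ys ++ cartesianProduct xs ys) f     ≡⟨ ∑-++ (map (x ,_) ys) _ f ⟩
      ∑ (map (x ,_) ys) f + ∑ (cartesianProduct xs ys) f ≡⟨ cong₂ _+_ (∑-map (x ,_) ys f) (∑-cartesianProduct xs ys f) ⟩
      ∑[ y ∈ ys ] f (x , y) + ∑[ x ∈ xs ] ∑[ y ∈ ys ] f (x , y) ∎
      where open ≡-Reasoning

    length-cartesianProduct : ∀ (xs : List A) (ys : List B) →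
                              length (cartesianProduct xs ys) ≡ length xs ℕ.* length ys
    length-cartesianProduct []       ys = refl
    length-cartesianProduct (x ∷ xs) ys = begin
      length (map (x ,_) ys ++ cartesianProduct xs ys)     ≡⟨ length-++ (map (x ,_) ys) ⟩
      length (map (x ,_) ys) ℕ.+ length (cartesianProduct xs ys)
        ≡⟨ cong₂ ℕ._+_ (length-map (x ,_) ys) (length-cartesianProduct xs ys) ⟩
      length ys ℕ.+ length xs ℕ.* length ys ∎
      where open ≡-Reasoning

  𝟙 : ∀ {p} {P : Set p} → Dec P → ℤ
  𝟙 (yes _) = 1ℤ
  𝟙 (no _)  = 0ℤ

  𝟙-×-dec : ∀ {p r} {P : Set p} {R : Set r} (P? : Dec P) (R? : Dec R) → 𝟙 P? * 𝟙 R? ≡ 𝟙 (P? ×-dec R?)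
  𝟙-×-dec (yes _) (yes _) = refl
  𝟙-×-dec (yes _) (no _)  = refl
  𝟙-×-dec (no _)  _       = refl

  𝟙-idem : ∀ {p} {P : Set p} (P? : Dec P) → 𝟙 P? * 𝟙 P? ≡ 𝟙 P?
  𝟙-idem (yes _) = refl
  𝟙-idem (no _)  = refl

  module _ {a p} {A : Set a} {P : A → Set p} (P? : ∀ x → Dec (P x)) where

    ∑-𝟙-none : ∀ {xs} → All (λ x → ¬ P x) xs → ∑[ x ∈ xs ] 𝟙 (P? x) ≡ 0ℤ
    ∑-𝟙-none {[]}     _              = refl
    ∑-𝟙-none {x ∷ xs} (¬Px ∷ ¬P[xs]) with P? x
    ... | yes Px = ⊥-elim (¬Px Px)
    ... | no _   = trans (ℤ.+-identityˡ _) (∑-𝟙-none ¬P[xs])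

    ∑-𝟙-unique : ∀ {xs} → Unique xs → ∀ {x₀} → x₀ ∈ xs → P x₀ → (∀ x → P x → x ≡ x₀) →
                 ∑[ x ∈ xs ] 𝟙 (P? x) ≡ 1ℤ
    ∑-𝟙-unique {x ∷ xs} (x∉xs ∷ _) (here refl) Px₀ only-x₀ with P? x
    ... | no ¬Px₀ = ⊥-elim (¬Px₀ Px₀)
    ... | yes _   = cong (_+_ 1ℤ) (∑-𝟙-none (All.map (λ x≢y Py → x≢y (sym (only-x₀ _ Py))) x∉xs))
    ∑-𝟙-unique {x ∷ xs} (x∉xs ∷ xs-unique) (there x₀∈xs) Px₀ only-x₀ with P? x
    ... | yes Px = ⊥-elim (All.lookup x∉xs x₀∈xs (only-x₀ x Px))
    ... | no _   = trans (ℤ.+-identityˡ _) (∑-𝟙-unique xs-unique x₀∈xs Px₀ only-x₀)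

  record Enumeration {a} (n : ℕ) (A : Set a) : Set a where
    field
      list     : List A
      unique   : Unique list
      complete : ∀ x → x ∈ list
      length≡  : length list ≡ n

  module _ {a} {A : Set a} {n} (E : Enumeration n A) where
    open Enumeration E

    ∑-𝟙-exactlyOne : ∀ {p} {P : A → Set p} (P? : ∀ x → Dec (P x)) →
                     ExactlyOne A P → ∑[ x ∈ list ] 𝟙 (P? x) ≡ 1ℤ
    ∑-𝟙-exactlyOne P? (x₀ , Px₀ , only-x₀) = ∑-𝟙-unique P? unique (complete x₀) Px₀ only-x₀

    ∑-enumeration-const : ∀ c → ∑[ _ ∈ list ] c ≡ + n * c
    ∑-enumeration-const c = trans (∑-const list c) (cong (λ k → + k * c) length≡)

  enumerate-Fin↔ : ∀ {a} {A : Set a} {n} → Fin n ↔ A → Enumeration n A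
  enumerate-Fin↔ {n = n} e = record
    { list     = map to (allFin n)
    ; unique   = Unique.map⁺ (Injection.injective (↔⇒↣ e)) (Unique.allFin⁺ n)
    ; complete = λ x → subst (_∈ map to (allFin n)) (strictlyInverseˡ x) (∈-map⁺ to (∈-allFin (from x)))
    ; length≡  = trans (length-map to (allFin n)) (length-tabulate (λ i → i))
    }
    where open Inverse e

  module FiniteLinearSpace
    {p ℓ r} {Point : Set p} {Line : Set ℓ}
    (_∈ₗ_ : Point → Line → Set r) (_∈ₗ?_ : ∀ x l → Dec (x ∈ₗ l)) (_≟_ : DecidableEquality Point)
    (q : ℕ) (lines : Enumeration (q ℕ.* suc q) Line)
    (degree : ∀ x → ∑[ l ∈ Enumeration.list lines ] 𝟙 (x ∈ₗ? l) ≡ 1ℤ + + q)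
    (join : ∀ {x y} → x ≢ y → ExactlyOne Line (λ l → x ∈ₗ l × y ∈ₗ l))
    where

    open Enumeration lines renaming (list to allLines)

    common-lines : ∀ x y → ∑[ l ∈ allLines ] (𝟙 (x ∈ₗ? l) * 𝟙 (y ∈ₗ? l)) ≡ 1ℤ + + q * 𝟙 (y ≟ x)
    common-lines x y with y ≟ x
    ... | yes refl = begin
      ∑[ l ∈ allLines ] (𝟙 (x ∈ₗ? l) * 𝟙 (x ∈ₗ? l)) ≡⟨ ∑-cong allLines (λ l → 𝟙-idem (x ∈ₗ? l)) ⟩
      ∑[ l ∈ allLines ] 𝟙 (x ∈ₗ? l)                  ≡⟨ degree x ⟩
      1ℤ + + q                                        ≡⟨ cong (_+_ 1ℤ) (ℤ.*-identityʳ (+ q)) ⟨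
      1ℤ + + q * 1ℤ                                   ∎
      where open ≡-Reasoning
    ... | no y≢x = begin
      ∑[ l ∈ allLines ] (𝟙 (x ∈ₗ? l) * 𝟙 (y ∈ₗ? l)) ≡⟨ ∑-cong allLines (λ l → 𝟙-×-dec (x ∈ₗ? l) (y ∈ₗ? l)) ⟩
      ∑[ l ∈ allLines ] 𝟙 (x ∈ₗ? l ×-dec y ∈ₗ? l)   ≡⟨ ∑-𝟙-exactlyOne lines (λ l → x ∈ₗ? l ×-dec y ∈ₗ? l) (join (λ x≡y → y≢x (sym x≡y))) ⟩
      1ℤ                                              ≡⟨ cong (_+_ 1ℤ) (ℤ.*-zeroʳ (+ q)) ⟨
      1ℤ + + q * 0ℤ                                   ∎
      where open ≡-Reasoning

    module _ (P : List Point) where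

      N : ℤ
      N = + length P

      pointsOn : Line → ℤ
      pointsOn l = ∑[ x ∈ P ] 𝟙 (x ∈ₗ? l)

      -- q times the deviation of pointsOn from its mean N (q + 1) / (q (q + 1)) = N / q.
      deviation : Line → ℤ
      deviation l = + q * pointsOn l - N

      ∑-pointsOn : ∑[ l ∈ allLines ] pointsOn l ≡ N * (1ℤ + + q)
      ∑-pointsOn = begin
        ∑[ l ∈ allLines ] ∑[ x ∈ P ] 𝟙 (x ∈ₗ? l) ≡⟨ ∑-swap allLines P (λ l x → 𝟙 (x ∈ₗ? l)) ⟩
        ∑[ x ∈ P ] ∑[ l ∈ allLines ] 𝟙 (x ∈ₗ? l) ≡⟨ ∑-cong P degree ⟩
        ∑[ x ∈ P ] (1ℤ + + q)                     ≡⟨ ∑-const P (1ℤ + + q) ⟩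
        N * (1ℤ + + q)                            ∎
        where open ≡-Reasoning

      ∑-pointsOn² : Unique P → ∑[ l ∈ allLines ] (pointsOn l * pointsOn l) ≡ N * (N + + q)
      ∑-pointsOn² P-unique = begin
        ∑[ l ∈ allLines ] (pointsOn l * pointsOn l)
          ≡⟨ ∑-cong allLines (λ l → ∑-*-∑ P P (λ x → 𝟙 (x ∈ₗ? l)) (λ y → 𝟙 (y ∈ₗ? l))) ⟩
        ∑[ l ∈ allLines ] ∑[ x ∈ P ] ∑[ y ∈ P ] (𝟙 (x ∈ₗ? l) * 𝟙 (y ∈ₗ? l))
          ≡⟨ ∑-swap allLines P _ ⟩
        ∑[ x ∈ P ] ∑[ l ∈ allLines ] ∑[ y ∈ P ] (𝟙 (x ∈ₗ? l) * 𝟙 (y ∈ₗ? l))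
          ≡⟨ ∑-cong P (λ x → ∑-swap allLines P _) ⟩
        ∑[ x ∈ P ] ∑[ y ∈ P ] ∑[ l ∈ allLines ] (𝟙 (x ∈ₗ? l) * 𝟙 (y ∈ₗ? l))
          ≡⟨ ∑-cong P (λ x → ∑-cong P (common-lines x)) ⟩
        ∑[ x ∈ P ] ∑[ y ∈ P ] (1ℤ + + q * 𝟙 (y ≟ x))
          ≡⟨ ∑-cong-∈ P row ⟩
        ∑[ x ∈ P ] (N + + q)
          ≡⟨ ∑-const P (N + + q) ⟩
        N * (N + + q) ∎
        where
        open ≡-Reasoning
        row : ∀ {x} → x ∈ P → ∑[ y ∈ P ] (1ℤ + + q * 𝟙 (y ≟ x)) ≡ N + + q
        row {x} x∈P = begin
          ∑[ y ∈ P ] (1ℤ + + q * 𝟙 (y ≟ x))            ≡⟨ ∑-+ P (λ _ → 1ℤ) (λ y → + q * 𝟙 (y ≟ x)) ⟩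
          ∑[ y ∈ P ] 1ℤ + ∑[ y ∈ P ] (+ q * 𝟙 (y ≟ x)) ≡⟨ cong₂ _+_ (trans (∑-const P 1ℤ) (ℤ.*-identityʳ N))
                                                                   (∑-*ˡ P (+ q) (λ y → 𝟙 (y ≟ x))) ⟩
          N + + q * ∑[ y ∈ P ] 𝟙 (y ≟ x)              ≡⟨ cong (λ k → N + + q * k)
                                                            (∑-𝟙-unique (_≟ x) P-unique x∈P refl (λ _ y≡x → y≡x)) ⟩
          N + + q * 1ℤ                                 ≡⟨ cong (_+_ N) (ℤ.*-identityʳ (+ q)) ⟩
          N + + q                                      ∎

      variance : Unique P → ∑[ l ∈ allLines ] (deviation l * deviation l) + + q * (N * N) ≡ + q * + q * + q * N
      variance P-unique = begin
        ∑[ l ∈ allLines ] (deviation l * deviation l) + + q * (N * N)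
          ≡⟨ cong (_+ + q * (N * N)) (∑-cong allLines (λ l → expand (+ q) N (pointsOn l))) ⟩
        ∑[ l ∈ allLines ] (+ q * + q * (pointsOn l * pointsOn l) + (- + 2 * + q * N * pointsOn l + N * N)) + + q * (N * N)
          ≡⟨ cong (_+ + q * (N * N)) linearity ⟩
        + q * + q * ∑[ l ∈ allLines ] (pointsOn l * pointsOn l) + (- + 2 * + q * N * ∑[ l ∈ allLines ] pointsOn l + + (q ℕ.* suc q) * (N * N)) + + q * (N * N)
          ≡⟨ cong₂ (λ u v → + q * + q * u + (- + 2 * + q * N * v + + (q ℕ.* suc q) * (N * N)) + + q * (N * N))
                   (∑-pointsOn² P-unique) ∑-pointsOn ⟩
        + q * + q * (N * (N + + q)) + (- + 2 * + q * N * (N * (1ℤ + + q)) + + (q ℕ.* suc q) * (N * N)) + + q * (N * N)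
          ≡⟨ cong (λ k → + q * + q * (N * (N + + q)) + (- + 2 * + q * N * (N * (1ℤ + + q)) + k * (N * N)) + + q * (N * N))
                  (ℤ.pos-* q (suc q)) ⟩
        + q * + q * (N * (N + + q)) + (- + 2 * + q * N * (N * (1ℤ + + q)) + + q * (1ℤ + + q) * (N * N)) + + q * (N * N)
          ≡⟨ simplify (+ q) N ⟩
        + q * + q * + q * N ∎
        where
        open ≡-Reasoning
        expand : ∀ q N n → (q * n - N) * (q * n - N) ≡ q * q * (n * n) + (- + 2 * q * N * n + N * N)
        expand = solve-∀
        simplify : ∀ q N → q * q * (N * (N + q)) + (- + 2 * q * N * (N * (1ℤ + q)) + q * (1ℤ + q) * (N * N)) + q * (N * N)
                           ≡ q * q * q * N
        simplify = solve-∀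
        linearity : ∑[ l ∈ allLines ] (+ q * + q * (pointsOn l * pointsOn l) + (- + 2 * + q * N * pointsOn l + N * N))
                    ≡ + q * + q * ∑[ l ∈ allLines ] (pointsOn l * pointsOn l)
                      + (- + 2 * + q * N * ∑[ l ∈ allLines ] pointsOn l + + (q ℕ.* suc q) * (N * N))
        linearity =
          trans (∑-+ allLines (λ l → + q * + q * (pointsOn l * pointsOn l)) (λ l → - + 2 * + q * N * pointsOn l + N * N))
                (cong₂ _+_ (∑-*ˡ allLines (+ q * + q) (λ l → pointsOn l * pointsOn l))
                           (trans (∑-+ allLines (λ l → - + 2 * + q * N * pointsOn l) (λ _ → N * N))
                                  (cong₂ _+_ (∑-*ˡ allLines (- + 2 * + q * N) pointsOn) (∑-enumeration-const lines (N * N)))))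

      deviation²-bound : Unique P → ∑[ l ∈ allLines ] (deviation l * deviation l) ≤ + q * + q * + q * N
      deviation²-bound P-unique = begin
        ∑[ l ∈ allLines ] (deviation l * deviation l)
          ≤⟨ ℤ.i≤i+j _ (+ (q ℕ.* (length P ℕ.* length P))) ⟩
        ∑[ l ∈ allLines ] (deviation l * deviation l) + + (q ℕ.* (length P ℕ.* length P))
          ≡⟨ cong (_+_ (∑[ l ∈ allLines ] (deviation l * deviation l))) (trans (ℤ.pos-* q _) (cong (+ q *_) (ℤ.pos-* (length P) (length P)))) ⟩
        ∑[ l ∈ allLines ] (deviation l * deviation l) + + q * (N * N)
          ≡⟨ variance P-unique ⟩
        + q * + q * + q * N ∎
        where open ℤ.≤-Reasoning

      incidence-bound : Unique P → ∀ L → Unique L →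
        (+ q * ∑[ l ∈ L ] pointsOn l - N * + length L) * (+ q * ∑[ l ∈ L ] pointsOn l - N * + length L)
          ≤ + q * + q * + q * (N * + length L)
      incidence-bound P-unique L L-unique = begin
        (+ q * ∑[ l ∈ L ] pointsOn l - N * + length L) * (+ q * ∑[ l ∈ L ] pointsOn l - N * + length L)
          ≡⟨ cong (λ k → k * k) ∑-deviation ⟨
        ∑ L deviation * ∑ L deviation
          ≤⟨ cauchy-schwarz L deviation ⟩
        + length L * ∑[ l ∈ L ] (deviation l * deviation l)
          ≤⟨ ℤ.*-monoˡ-≤-nonNeg (+ length L)
               (∑-mono-⊆ (λ l → square-nonNeg (deviation l)) L-unique (λ {l} _ → complete l)) ⟩
        + length L * ∑[ l ∈ allLines ] (deviation l * deviation l)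
          ≤⟨ ℤ.*-monoˡ-≤-nonNeg (+ length L) (deviation²-bound P-unique) ⟩
        + length L * (+ q * + q * + q * N)
          ≡⟨ reorder (+ length L) (+ q) N ⟩
        + q * + q * + q * (N * + length L) ∎
        where
        open ℤ.≤-Reasoning
        reorder : ∀ l q N → l * (q * q * q * N) ≡ q * q * q * (N * l)
        reorder = solve-∀
        ∑-deviation : ∑ L deviation ≡ + q * ∑[ l ∈ L ] pointsOn l - N * + length L
        ∑-deviation = begin-equality
          ∑[ l ∈ L ] (+ q * pointsOn l - N)               ≡⟨ ∑-+ L (λ l → + q * pointsOn l) (λ _ → - N) ⟩
          ∑[ l ∈ L ] (+ q * pointsOn l) + ∑[ _ ∈ L ] (- N) ≡⟨ cong₂ _+_ (∑-*ˡ L (+ q) pointsOn) (∑-const L (- N)) ⟩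
          + q * ∑ L pointsOn + + length L * (- N)         ≡⟨ tidy (+ q * ∑ L pointsOn) (+ length L) N ⟩
          + q * ∑ L pointsOn - N * + length L             ∎
          where
          tidy : ∀ a l N → a + l * (- N) ≡ a - N * l
          tidy = solve-∀

  module QuasifieldPlane {c} (Q : Quasifield c) (_≟_ : DecidableEquality (Quasifield.Carrier Q))
                         {q} (elements : Enumeration q (Quasifield.Carrier Q)) where

    open Quasifield Q renaming (_+_ to _⊕_; -_ to ⊖_)
    open IsGroup +-isGroup using (assoc; identityˡ; _\\_; _//_)

    +-group : Group c c
    +-group = record { Carrier = Carrier; _≈_ = _≡_; _∙_ = _⊕_; ε = 0#; _⁻¹ = ⊖_; isGroup = +-isGroup }

    open GroupProperties +-group
      using (\\-leftDividesˡ; \\-leftDividesʳ; //-rightDividesˡ; //-rightDividesʳ)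
    open Enumeration elements
      using () renaming (list to allElements; unique to elements-unique; complete to elements-complete)

    exactlyOne-⊕ʳ : ∀ u y → ExactlyOne Carrier (λ a → y ≡ u ⊕ a)
    exactlyOne-⊕ʳ u y =
      u \\ y , sym (\\-leftDividesˡ u y) , λ a y≡u⊕a → trans (sym (\\-leftDividesʳ u a)) (cong (u \\_) (sym y≡u⊕a))

    -- ·-rightDiv only solves for nonzero t; for t = 0 the loop axioms force b = 0.
    exactlyOne-·ˡ : ∀ {d} → d ≢ 0# → ∀ t → ExactlyOne Carrier (λ b → b · d ≡ t)
    exactlyOne-·ˡ {d} d≢0 t with t ≟ 0#
    ... | yes refl = 0# , zeroˡ d , only-0
      where
      only-0 : ∀ b → b · d ≡ 0# → b ≡ 0#
      only-0 b b·d≡0 with b ≟ 0#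
      ... | yes b≡0 = b≡0
      ... | no b≢0  = ⊥-elim (·-closed b d b≢0 d≢0 b·d≡0)
    ... | no t≢0 with ·-rightDiv d t d≢0 t≢0
    ... | b₀ , (_ , b₀·d≡t) , only-b₀ = b₀ , b₀·d≡t , only
      where
      only : ∀ b → b · d ≡ t → b ≡ b₀
      only b b·d≡t with b ≟ 0#
      ... | yes refl = ⊥-elim (t≢0 (trans (sym b·d≡t) (zeroˡ d)))
      ... | no b≢0   = only-b₀ b (b≢0 , b·d≡t)

    nonverticals verticals : List (Line Q)
    nonverticals = map (uncurry nonvertical) (cartesianProduct allElements allElements)
    verticals    = map vertical allElements

    lines : Enumeration (q ℕ.* suc q) (Line Q)
    lines = record
      { list     = nonverticals ++ verticals
      ; unique   = Unique.++⁺ (Unique.map⁺ (λ { {_ , _} {_ , _} refl → refl })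
                                            (Unique.cartesianProduct⁺ elements-unique elements-unique))
                              (Unique.map⁺ (λ { refl → refl }) elements-unique)
                              disjoint
      ; complete = complete
      ; length≡  = length≡
      }
      where
      disjoint : ∀ {l} → ¬ (l ∈ nonverticals × l ∈ verticals)
      disjoint (l∈nonverticals , l∈verticals)
        with _ , _ , refl ← ∈-map⁻ (uncurry nonvertical) l∈nonverticals
        with _ , _ , ()   ← ∈-map⁻ vertical l∈verticals
      complete : ∀ l → l ∈ nonverticals ++ verticals
      complete (nonvertical b a) = ∈-++⁺ˡ (∈-map⁺ (uncurry nonvertical)
                                     (∈-cartesianProduct⁺ (elements-complete b) (elements-complete a)))
      complete (vertical a)      = ∈-++⁺ʳ nonverticals (∈-map⁺ vertical (elements-complete a))
      length≡ : length (nonverticals ++ verticals) ≡ q ℕ.* suc q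
      length≡ = begin
        length (nonverticals ++ verticals)       ≡⟨ length-++ nonverticals ⟩
        length nonverticals ℕ.+ length verticals
          ≡⟨ cong₂ ℕ._+_ (trans (length-map _ (cartesianProduct allElements allElements))
                                (length-cartesianProduct allElements allElements))
                         (length-map vertical allElements) ⟩
        length allElements ℕ.* length allElements ℕ.+ length allElements
          ≡⟨ cong (λ n → n ℕ.* n ℕ.+ n) (Enumeration.length≡ elements) ⟩
        q ℕ.* q ℕ.+ q                            ≡⟨ ℕ.+-comm (q ℕ.* q) q ⟩
        q ℕ.+ q ℕ.* q                            ≡⟨ ℕ.*-suc q q ⟨
        q ℕ.* suc q                              ∎
        where open ≡-Reasoning

    ∑-lines : ∀ (f : Line Q → ℤ) → ∑ (Enumeration.list lines) f
              ≡ ∑[ b ∈ allElements ] ∑[ a ∈ allElements ] f (nonvertical b a) + ∑[ a ∈ allElements ] f (vertical a)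
    ∑-lines f = trans (∑-++ nonverticals verticals f)
      (cong₂ _+_ (trans (∑-map (uncurry nonvertical) (cartesianProduct allElements allElements) f)
                        (∑-cartesianProduct allElements allElements (λ ba → f (uncurry nonvertical ba))))
                 (∑-map vertical allElements f))

    degree : ∀ p → ∑[ l ∈ Enumeration.list lines ] 𝟙 (_∈ₗ?_ Q _≟_ p l) ≡ 1ℤ + + q
    degree (x , y) = begin
      ∑[ l ∈ Enumeration.list lines ] 𝟙 (_∈ₗ?_ Q _≟_ (x , y) l)
        ≡⟨ ∑-lines (λ l → 𝟙 (_∈ₗ?_ Q _≟_ (x , y) l)) ⟩
      ∑[ b ∈ allElements ] ∑[ a ∈ allElements ] 𝟙 (y ≟ ((b · x) ⊕ a)) + ∑[ a ∈ allElements ] 𝟙 (x ≟ a)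
        ≡⟨ cong₂ _+_ (∑-cong allElements (λ b → ∑-𝟙-exactlyOne elements (λ a → y ≟ ((b · x) ⊕ a)) (exactlyOne-⊕ʳ (b · x) y)))
                     (∑-𝟙-exactlyOne elements (x ≟_) (x , refl , λ _ x≡a → sym x≡a)) ⟩
      ∑[ b ∈ allElements ] 1ℤ + 1ℤ
        ≡⟨ cong (_+ 1ℤ) (trans (∑-enumeration-const elements 1ℤ) (ℤ.*-identityʳ (+ q))) ⟩
      + q + 1ℤ
        ≡⟨ ℤ.+-comm (+ q) 1ℤ ⟩
      1ℤ + + q ∎
      where open ≡-Reasoning

    -- The slope b of the line through (x , y) and (x′ , y′) is the solution of
    -- b · (x′ // x) ≡ y′ // y, by left distributivity.
    join : ∀ {p p′} → p ≢ p′ → ExactlyOne (Line Q) (λ l → _∈ₗ_ Q p l × _∈ₗ_ Q p′ l)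
    join {x , y} {x′ , y′} p≢p′ with x ≟ x′
    ... | yes refl = vertical x , (refl , refl) , only
      where
      only : ∀ l → _∈ₗ_ Q (x , y) l × _∈ₗ_ Q (x , y′) l → l ≡ vertical x
      only (nonvertical b a) (y≡ , y′≡) = ⊥-elim (p≢p′ (cong (x ,_) (trans y≡ (sym y′≡))))
      only (vertical a)      (x≡a , _)  = cong vertical (sym x≡a)
    ... | no x≢x′ = nonvertical b₀ a₀ , (sym (\\-leftDividesˡ (b₀ · x) y) , on₀) , only
      where
      d t : Carrier
      d = x′ // x
      t = y′ // y

      d≢0 : d ≢ 0#
      d≢0 d≡0 = x≢x′ (sym (begin
        x′          ≡⟨ //-rightDividesˡ x x′ ⟨
        d ⊕ x       ≡⟨ cong (_⊕ x) d≡0 ⟩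
        0# ⊕ x      ≡⟨ identityˡ x ⟩
        x           ∎))
        where open ≡-Reasoning

      split : ∀ b a → (b · x′) ⊕ a ≡ (b · d) ⊕ ((b · x) ⊕ a)
      split b a = begin
        (b · x′) ⊕ a              ≡⟨ cong (λ z → (b · z) ⊕ a) (//-rightDividesˡ x x′) ⟨
        (b · (d ⊕ x)) ⊕ a         ≡⟨ cong (_⊕ a) (distribˡ b d x) ⟩
        ((b · d) ⊕ (b · x)) ⊕ a   ≡⟨ assoc (b · d) (b · x) a ⟩
        (b · d) ⊕ ((b · x) ⊕ a)   ∎
        where open ≡-Reasoning

      slope : ∀ {b a} → y ≡ (b · x) ⊕ a → y′ ≡ (b · x′) ⊕ a → b · d ≡ t
      slope {b} {a} y≡ y′≡ = sym (begin
        y′ // y                   ≡⟨ cong (_// y) (trans y′≡ (split b a)) ⟩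
        ((b · d) ⊕ ((b · x) ⊕ a)) // y ≡⟨ cong (λ z → ((b · d) ⊕ z) // y) y≡ ⟨
        ((b · d) ⊕ y) // y        ≡⟨ //-rightDividesʳ y (b · d) ⟩
        b · d                     ∎)
        where open ≡-Reasoning

      b₀ a₀ : Carrier
      b₀ = proj₁ (exactlyOne-·ˡ d≢0 t)
      a₀ = (b₀ · x) \\ y

      on₀ : y′ ≡ (b₀ · x′) ⊕ a₀
      on₀ = begin
        y′                    ≡⟨ //-rightDividesˡ y y′ ⟨
        t ⊕ y                 ≡⟨ cong₂ _⊕_ (proj₁ (proj₂ (exactlyOne-·ˡ d≢0 t))) (\\-leftDividesˡ (b₀ · x) y) ⟨
        (b₀ · d) ⊕ ((b₀ · x) ⊕ a₀) ≡⟨ split b₀ a₀ ⟨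
        (b₀ · x′) ⊕ a₀            ∎
        where open ≡-Reasoning

      only : ∀ l → _∈ₗ_ Q (x , y) l × _∈ₗ_ Q (x′ , y′) l → l ≡ nonvertical b₀ a₀
      only (nonvertical b a) (y≡ , y′≡) = cong₂ nonvertical b≡b₀ (trans a≡ (cong (λ b → (b · x) \\ y) b≡b₀))
        where
        b≡b₀ : b ≡ b₀
        b≡b₀ = proj₂ (proj₂ (exactlyOne-·ˡ d≢0 t)) b (slope y≡ y′≡)
        a≡ : a ≡ (b · x) \\ y
        a≡ = proj₂ (proj₂ (exactlyOne-⊕ʳ (b · x) y)) a y≡
      only (vertical a)      (x≡a , x′≡a) = ⊥-elim (x≢x′ (trans x≡a (sym x′≡a)))

    open FiniteLinearSpace (_∈ₗ_ Q) (_∈ₗ?_ Q _≟_) (≡-dec _≟_ _≟_) q lines degree join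

    -- The `_` is the line counter local to `incidences`, which cannot be named; it is
    -- solved from the use in `incidences-∷`, whose enclosing list is abstracted as Y.
    incidences-∷ : ∀ p P L → + incidences Q _≟_ (p ∷ P) L ≡ ∑[ l ∈ L ] 𝟙 (_∈ₗ?_ Q _≟_ p l) + + incidences Q _≟_ P L
    counter≡∑ : ∀ p (P : List (Carrier × Carrier)) (Y L : List (Line Q)) → + _ ≡ ∑[ l ∈ L ] 𝟙 (_∈ₗ?_ Q _≟_ p l)

    incidences-∷ p P []      = refl
    incidences-∷ p P (l ∷ L) with _∈ₗ?_ Q _≟_ p l | l ∷ L
    ... | yes _ | Y = trans (ℤ.pos-+ (suc _) (incidences Q _≟_ P Y))
                            (cong (_+ + incidences Q _≟_ P Y) (cong (_+_ 1ℤ) (counter≡∑ p P Y L)))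
    ... | no _  | Y = trans (ℤ.pos-+ _ (incidences Q _≟_ P Y))
                            (cong (_+ + incidences Q _≟_ P Y) (trans (counter≡∑ p P Y L) (sym (ℤ.+-identityˡ _))))

    counter≡∑ p P Y []      = refl
    counter≡∑ p P Y (l ∷ L) with _∈ₗ?_ Q _≟_ p l
    ... | yes _ = cong (_+_ 1ℤ) (counter≡∑ p P Y L)
    ... | no _  = trans (counter≡∑ p P Y L) (sym (ℤ.+-identityˡ _))

    incidences≡∑-pointsOn : ∀ P L → + incidences Q _≟_ P L ≡ ∑[ l ∈ L ] pointsOn P l
    incidences≡∑-pointsOn []      L = sym (∑-zero L)
    incidences≡∑-pointsOn (p ∷ P) L = begin
      + incidences Q _≟_ (p ∷ P) L                               ≡⟨ incidences-∷ p P L ⟩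
      ∑[ l ∈ L ] 𝟙 (_∈ₗ?_ Q _≟_ p l) + + incidences Q _≟_ P L     ≡⟨ cong (_+_ (∑[ l ∈ L ] 𝟙 (_∈ₗ?_ Q _≟_ p l))) (incidences≡∑-pointsOn P L) ⟩
      ∑[ l ∈ L ] 𝟙 (_∈ₗ?_ Q _≟_ p l) + ∑[ l ∈ L ] pointsOn P l     ≡⟨ ∑-+ L (λ l → 𝟙 (_∈ₗ?_ Q _≟_ p l)) (pointsOn P) ⟨
      ∑[ l ∈ L ] pointsOn (p ∷ P) l                              ∎
      where open ≡-Reasoning

    incidences-bound : ∀ P → Unique P → ∀ L → Unique L →
      (q ℕ.* incidences Q _≟_ P L ∸ length P ℕ.* length L) ^ 2 ℕ.≤ q ^ 3 ℕ.* (length P ℕ.* length L)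
    incidences-bound P P-unique L L-unique = ∸-squared-≤ (q ℕ.* I) (length P ℕ.* length L) _ (begin
      (+ (q ℕ.* I) - + (length P ℕ.* length L)) * (+ (q ℕ.* I) - + (length P ℕ.* length L))
        ≡⟨ cong (λ i → i * i) (cong₂ _-_ (trans (ℤ.pos-* q I) (cong (+ q *_) (incidences≡∑-pointsOn P L)))
                                         (ℤ.pos-* (length P) (length L))) ⟩
      (+ q * ∑[ l ∈ L ] pointsOn P l - N P * + length L) * (+ q * ∑[ l ∈ L ] pointsOn P l - N P * + length L)
        ≤⟨ incidence-bound P P-unique L L-unique ⟩
      + q * + q * + q * (N P * + length L)
        ≡⟨ trans (ℤ.pos-* (q ^ 3) (length P ℕ.* length L)) (cong₂ _*_ (pos-^3 q) (ℤ.pos-* (length P) (length L))) ⟨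
      + (q ^ 3 ℕ.* (length P ℕ.* length L)) ∎)
      where
      open ℤ.≤-Reasoning
      I : ℕ
      I = incidences Q _≟_ P L

open import Defs
open import Data.Nat using (ℕ; _*_; _∸_; _^_; _≤_)
open import Data.Fin using (Fin)
open import Data.Product using (_×_)
open import Data.List using (List; length)
open import Data.List.Relation.Unary.Unique.Propositional using (Unique)
open import Function.Bundles using (_↔_)

open PlaneIncidences using (enumerate-Fin↔; module QuasifieldPlane)

theorem1p6 : ∀ {c} (Q : Quasifield c) (q : ℕ) (e : Fin q ↔ Quasifield.Carrier Q)
    (P : List (Quasifield.Carrier Q × Quasifield.Carrier Q)) → Unique P →
    (L : List (Line Q)) → Unique L →
    (q * incidences Q (finDecEq e) P L ∸ length P * length L) ^ 2
    ≤ q ^ 3 * (length P * length L)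
theorem1p6 Q q e = QuasifieldPlane.incidences-bound Q (finDecEq e) (enumerate-Fin↔ e)
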